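{- Let $\theta$ be an ATL-formula and let $\mathcal H=(\Sigma,S,d,\delta,H)$ be a (perfect-recall) concurrent game Hintikka structure for $\theta$. Then $\mathcal H$ can be expanded to a CGM satisfying $\theta$: there is a labeling $L:S\to\mathcal P(AP)$ (namely $L(s)=H(s)\cap AP$) such that the CGM $(\Sigma,S,d,\delta,AP,L)$ satisfies $\theta$ at some state.
   Context: ATL-formulae over a set AP of atoms and a finite non-empty agent set $\Sigma$: $\varphi ::= p \mid \neg\varphi \mid (\varphi_1\to\varphi_2)\mid \langle\langle A\rangle\rangle\bigcirc\varphi \mid \langle\langle A\rangle\rangle\Box\varphi \mid \langle\langle A\rangle\rangle \varphi_1\,\mathcal{U}\,\varphi_2$, $A\subseteq\Sigma$; $\wedge$, $\top$ defined as usual. A concurrent game frame (CGF) is $(\Sigma,S,d,\delta)$ with $S\ne\emptyset$, $d_a(s)\ge1$ moves $D_a(s)=\{0,\dots,d_a(s)-1\}$ for agent $a$ at $s$, move vectors $D(s)=\prod_a D_a(s)$, and $\delta(s,\sigma)\in S$; a CGM additionally has $AP$ and $L:S\to\mathcal P(AP)$. An $A$-move $\sigma_A$ at $s$ picks a move for each $a\in A$; $out(s,\sigma_A)=\{\delta(s,\sigma):\sigma\in D(s)\text{ agrees with }\sigma_A\text{ on }A\}$. A co-$A$-move at $s$ is a function $c$ from $A$-moves at $s$ to $D(s)$ with $c(\sigma_A)$ agreeing with $\sigma_A$ on $A$; $out(s,c)=\{\delta(s,c(\sigma_A))\}$. A run is an infinite sequence of states each a $\delta$-successor of the previous one. A perfect-recall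 $A$-strategy (resp. co-$A$-strategy) $F$ maps each non-empty finite sequence of states ending at $t$ to an $A$-move (resp. co-$A$-move) at $t$; $out(s,F)$ is the set of runs $\lambda$ with $\lambda[0]=s$ and $\lambda[i+1]\in out(\lambda[i],F(\lambda[0],\dots,\lambda[i]))$. Satisfaction in a CGM: $s\Vdash p$ iff $p\in L(s)$; Boolean clauses usual; $s\Vdash\langle\langle A\rangle\rangle\bigcirc\varphi$ iff some $A$-move at $s$ has $\varphi$ true throughout its outcome; $s\Vdash\langle\langle A\rangle\rangle\Box\varphi$ iff some perfect-recall $A$-strategy $F$ has $\varphi$ true at every position of every $\lambda\in out(s,F)$; $s\Vdash\langle\langle A\rangle\rangle\varphi\,\mathcal U\,\psi$ iff some perfect-recall $A$-strategy $F$ ensures each $\lambda\in out(s,F)$ has $i$ with $\psi$ at $\lambda[i]$ and $\varphi$ at $\lambda[j]$ for $j<i$. $\alpha$-formulae and components: $\neg\neg\varphi$ ($\varphi,\varphi$); $\neg(\varphi\to\psi)$ ($\varphi,\neg\psi$); $\neg\langle\langle\Sigma\rangle\rangle\bigcirc\varphi$ ($\langle\langle\emptyset\rangle\rangle\bigcirc\neg\varphi$ twice); $\langle\langle A\rangle\rangle\Box\varphi$ ($\varphi$, $\langle\langle A\rangle\rangle\bigcirc\langle\langle A\rangle\rangle\Box\varphi$). $\beta$-formulae and components: $\varphi\to\psi$ ($\neg\varphi$, $\psi$); $\langle\langle A\rangle\rangle\varphi\,\mathcal U\,\psi$ ($\psi$, $\varphi\wedge\langle\langle A\rangle\rangle\bigcirc\langle\langle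 A\rangle\rangle\varphi\,\mathcal U\,\psi$); $\neg\langle\langle A\rangle\rangle\varphi\,\mathcal U\,\psi$ ($\neg\psi\wedge\neg\varphi$, $\neg\psi\wedge\neg\langle\langle A\rangle\rangle\bigcirc\langle\langle A\rangle\rangle\varphi\,\mathcal U\,\psi$); $\neg\langle\langle A\rangle\rangle\Box\varphi$ ($\neg\varphi$, $\neg\langle\langle A\rangle\rangle\bigcirc\langle\langle A\rangle\rangle\Box\varphi$). A (perfect-recall) concurrent game Hintikka structure (CGHS) is $(\Sigma,S,d,\delta,H)$ where $(\Sigma,S,d,\delta)$ is a CGF and $H$ labels each $s\in S$ with a set of ATL-formulae such that: (H1) if $\neg\varphi\in H(s)$ then $\varphi\notin H(s)$; (H2) if $\alpha\in H(s)$ then $\alpha_1,\alpha_2\in H(s)$; (H3) if $\beta\in H(s)$ then $\beta_1\in H(s)$ or $\beta_2\in H(s)$; (H4) if $\langle\langle A\rangle\rangle\bigcirc\varphi\in H(s)$ there is an $A$-move $\sigma_A$ at $s$ with $\varphi\in H(s')$ for all $s'\in out(s,\sigma_A)$; (H5) if $\neg\langle\langle A\rangle\rangle\bigcirc\varphi\in H(s)$ there is a co-$A$-move $c$ at $s$ with $\neg\varphi\in H(s')$ for all $s'\in out(s,c)$; (H6) if $\langle\langle A\rangle\rangle\varphi\,\mathcal U\,\psi\in H(s)$ there is a perfect-recall $A$-strategy $F$ such that every $\lambda\in out(s,F)$ has $i\ge0$ with $\psi\in H(\lambda[i])$ and $\varphi\in H(\lambda[j])$ for all $j<i$; (H7)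 if $\neg\langle\langle A\rangle\rangle\Box\varphi\in H(s)$ there is a perfect-recall co-$A$-strategy $F$ such that every $\lambda\in out(s,F)$ has $i\ge0$ with $\neg\varphi\in H(\lambda[i])$. It is a CGHS for $\theta$ if $\theta\in H(s)$ for some $s\in S$. -}

module Defs where

open import Data.Nat using (ℕ; zero; suc; _≤_; _<_)
open import Data.Fin using (Fin)
open import Data.Fin.Subset using (Subset; _∈_) renaming (⊤ to Full; ⊥ to Empty)
open import Data.Bool using (Bool; true)
open import Data.List using (List; map; upTo)
open import Data.Product using (Σ; _×_; proj₁)
open import Data.Sum using (_⊎_)
open import Relation.Binary.PropositionalEquality using (_≡_)
open import Relation.Nullary using (¬_)

-- ATL formulae over atoms AP and agents Σ = Fin n; coalitions A ⊆ Σ are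
-- subsets  Subset n.

infixr 4 _⇒_
infix 6 ~_

data Formula (n : ℕ) (AP : Set) : Set where
  atom    : AP → Formula n AP
  ~_      : Formula n AP → Formula n AP
  _⇒_     : Formula n AP → Formula n AP → Formula n AP
  ⟪_⟫○_   : Subset n → Formula n AP → Formula n AP
  ⟪_⟫□_   : Subset n → Formula n AP → Formula n AP
  ⟪_⟫_𝒰_  : Subset n → Formula n AP → Formula n AP → Formula n AP

_∧_ : ∀ {n AP} → Formula n AP → Formula n AP → Formula n AP
φ ∧ ψ = ~ (φ ⇒ ~ ψ)

-- Concurrent game frames.  D_a(s) = Fin (d s a).

record CGF (n : ℕ) : Set₁ where
  field
    S     : Set
    d     : S → Fin n → ℕ
    d-pos : ∀ s a → 1 ≤ d s a
    δ     : (s : S) → ((a : Fin n) → Fin (d s a)) → S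

module Frame {n : ℕ} (F : CGF n) where
  open CGF F

  Move : S → Set
  Move s = (a : Fin n) → Fin (d s a)

  AMove : Subset n → S → Set
  AMove A s = (a : Fin n) → a ∈ A → Fin (d s a)

  Agrees : (A : Subset n) (s : S) → Move s → AMove A s → Set
  Agrees A s σ σA = ∀ a (p : a ∈ A) → σ a ≡ σA a p

  InOut : (A : Subset n) (s : S) → AMove A s → S → Set
  InOut A s σA s' = Σ (Move s) λ σ → Agrees A s σ σA × δ s σ ≡ s'

  CoAMove : Subset n → S → Set
  CoAMove A s = Σ (AMove A s → Move s) λ c → ∀ σA → Agrees A s (c σA) σA

  InCoOut : (A : Subset n) (s : S) → CoAMove A s → S → Set
  InCoOut A s c s' = Σ (AMove A s) λ σA → δ s (proj₁ c σA) ≡ s'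

  -- perfect-recall strategies: a non-empty finite sequence of states
  -- ending at t is represented as (hist , t), the sequence being hist ++ [t].
  Strategy : Subset n → Set
  Strategy A = (hist : List S) (t : S) → AMove A t

  CoStrategy : Subset n → Set
  CoStrategy A = (hist : List S) (t : S) → CoAMove A t

  prefix : (ℕ → S) → ℕ → List S
  prefix r i = map r (upTo i)

  InOutS : (A : Subset n) → S → Strategy A → (ℕ → S) → Set
  InOutS A s G r = (r 0 ≡ s) × (∀ i → InOut A (r i) (G (prefix r i) (r i)) (r (suc i)))

  InOutCoS : (A : Subset n) → S → CoStrategy A → (ℕ → S) → Set
  InOutCoS A s G r = (r 0 ≡ s) × (∀ i → InCoOut A (r i) (G (prefix r i) (r i)) (r (suc i)))

-- Satisfaction in the CGM (F, AP, L).  Subsets of AP are represented by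
-- their characteristic functions AP → Bool.

module Semantics {n : ℕ} {AP : Set} (F : CGF n) (L : CGF.S F → AP → Bool) where
  open CGF F
  open Frame F

  Sat : S → Formula n AP → Set
  Sat s (atom p) = L s p ≡ true
  Sat s (~ φ) = ¬ Sat s φ
  Sat s (φ ⇒ ψ) = Sat s φ → Sat s ψ
  Sat s (⟪ A ⟫○ φ) = Σ (AMove A s) λ σA → ∀ s' → InOut A s σA s' → Sat s' φ
  Sat s (⟪ A ⟫□ φ) = Σ (Strategy A) λ G → ∀ r → InOutS A s G r → ∀ i → Sat (r i) φ
  Sat s (⟪ A ⟫ φ 𝒰 ψ) = Σ (Strategy A) λ G → ∀ r → InOutS A s G r →
    Σ ℕ λ i → Sat (r i) ψ × (∀ j → j < i → Sat (r j) φ)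

-- Concurrent game Hintikka structures.  H(s) is a set of formulae,
-- represented by its characteristic function; φ ∈ H(s) iff H s φ ≡ true.

record CGHS (n : ℕ) (AP : Set) : Set₁ where
  field
    frame : CGF n
  open CGF frame public
  open Frame frame public
  field
    H : S → Formula n AP → Bool

  _∋_ : S → Formula n AP → Set
  s ∋ φ = H s φ ≡ true

  field
    H1 : ∀ s φ → s ∋ (~ φ) → ¬ (s ∋ φ)
    H2-¬¬ : ∀ s φ → s ∋ (~ ~ φ) → s ∋ φ
    H2-¬⇒ : ∀ s φ ψ → s ∋ (~ (φ ⇒ ψ)) → (s ∋ φ) × (s ∋ (~ ψ))
    H2-¬Σ○ : ∀ s φ → s ∋ (~ (⟪ Full ⟫○ φ)) → s ∋ (⟪ Empty ⟫○ (~ φ))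
    H2-□ : ∀ s A φ → s ∋ (⟪ A ⟫□ φ) → (s ∋ φ) × (s ∋ (⟪ A ⟫○ (⟪ A ⟫□ φ)))
    H3-⇒ : ∀ s φ ψ → s ∋ (φ ⇒ ψ) → (s ∋ (~ φ)) ⊎ (s ∋ ψ)
    H3-𝒰 : ∀ s A φ ψ → s ∋ (⟪ A ⟫ φ 𝒰 ψ) →
      (s ∋ ψ) ⊎ (s ∋ (φ ∧ (⟪ A ⟫○ (⟪ A ⟫ φ 𝒰 ψ))))
    H3-¬𝒰 : ∀ s A φ ψ → s ∋ (~ (⟪ A ⟫ φ 𝒰 ψ)) →
      (s ∋ ((~ ψ) ∧ (~ φ))) ⊎ (s ∋ ((~ ψ) ∧ (~ (⟪ A ⟫○ (⟪ A ⟫ φ 𝒰 ψ)))))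
    H3-¬□ : ∀ s A φ → s ∋ (~ (⟪ A ⟫□ φ)) →
      (s ∋ (~ φ)) ⊎ (s ∋ (~ (⟪ A ⟫○ (⟪ A ⟫□ φ))))
    H4 : ∀ s A φ → s ∋ (⟪ A ⟫○ φ) →
      Σ (AMove A s) λ σA → ∀ s' → InOut A s σA s' → s' ∋ φ
    H5 : ∀ s A φ → s ∋ (~ (⟪ A ⟫○ φ)) →
      Σ (CoAMove A s) λ c → ∀ s' → InCoOut A s c s' → s' ∋ (~ φ)
    H6 : ∀ s A φ ψ → s ∋ (⟪ A ⟫ φ 𝒰 ψ) →
      Σ (Strategy A) λ G → ∀ r → InOutS A s G r →
        Σ ℕ λ i → (r i ∋ ψ) × (∀ j → j < i → r j ∋ φ)
    H7 : ∀ s A φ → s ∋ (~ (⟪ A ⟫□ φ)) →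
      Σ (CoStrategy A) λ G → ∀ r → InOutCoS A s G r →
        Σ ℕ λ i → r i ∋ (~ φ)

  label : S → AP → Bool
  label s p = H s (atom p)

IsFor : ∀ {n AP} → CGHS n AP → Formula n AP → Set
IsFor 𝓗 θ = Σ (CGHS.S 𝓗) λ s → CGHS._∋_ 𝓗 s θ

SatisfiedInExpansion : ∀ {n AP} → CGHS n AP → Formula n AP → Set
SatisfiedInExpansion 𝓗 θ =
  Σ (CGHS.S 𝓗) λ s → Semantics.Sat (CGHS.frame 𝓗) (CGHS.label 𝓗) s θ

-- Truth lemma: by simultaneous induction on φ, φ ∈ H(s) implies s ⊨ φ and
-- ¬φ ∈ H(s) implies s ⊭ φ.  The next-time cases are (H4) and (H5).  For
-- ⟪A⟫□φ the α-rule and (H4) make the formula self-propagating, so always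
-- playing the (H4)-move keeps it in every label along the outcome.  For the
-- negated path formulas, a claimed strategy is played against a co-strategy
-- from the Hintikka conditions ((H7) for □; (H5) applied repeatedly for 𝒰,
-- which the β-rule forces as long as φ holds): the joint run lies in both
-- outcomes and yields a contradiction.
module Submission where

open import Defs
open import Data.Nat using (ℕ; zero; suc; _≤_; _<_)
open import Data.Nat.Properties using (≤-refl; m<n⇒m<1+n)
open import Data.Fin using (fromℕ<)
open import Data.Fin.Subset using (Subset)
open import Data.Fin.Subset.Properties using (_∈?_)
open import Data.Vec.Properties.WithK using ([]=-irrelevant)
open import Data.Bool using (Bool; true; false)
open import Data.List using (List; []; _∷_; _∷ʳ_; map; upTo)
open import Data.List.Properties using (map-++; upTo-∷ʳ)
open import Data.Product using (_×_; _,_; proj₁; proj₂)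
open import Data.Sum using (inj₁; inj₂; [_,_]′)
open import Data.Empty using (⊥-elim)
open import Relation.Nullary using (¬_; yes; no)
open import Relation.Binary.PropositionalEquality using (_≡_; refl; sym; cong; subst; module ≡-Reasoning)

choose : {X : Set} (b : Bool) → (b ≡ true → X) → X → X
choose true  f _ = f refl
choose false _ x = x

choose-true : {X : Set} (P : X → Set) (b : Bool) (f : b ≡ true → X) (x : X) →
              (∀ e → P (f e)) → b ≡ true → P (choose b f x)
choose-true P true f x Pf refl = Pf refl

module Outcomes {n : ℕ} (F : CGF n) where
  open CGF F
  open Frame F

  defaultMove : (t : S) → Move t
  defaultMove t a = fromℕ< (d-pos t a)

  defaultAMove : (A : Subset n) (t : S) → AMove A t
  defaultAMove A t a _ = defaultMove t a

  extendAMove : (A : Subset n) (t : S) → AMove A t → Move t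
  extendAMove A t σA a with a ∈? A
  ... | yes a∈A = σA a a∈A
  ... | no  _   = defaultMove t a

  extendAMove-agrees : (A : Subset n) (t : S) (σA : AMove A t) → Agrees A t (extendAMove A t σA) σA
  extendAMove-agrees A t σA a a∈A with a ∈? A
  ... | yes a∈A′ = cong (σA a) ([]=-irrelevant a∈A′ a∈A)
  ... | no  a∉A  = ⊥-elim (a∉A a∈A)

  defaultCoAMove : (A : Subset n) (t : S) → CoAMove A t
  defaultCoAMove A t = extendAMove A t , extendAMove-agrees A t

  -- history i accumulates the prefix λ[0..i-1] together with λ[i], so that
  -- next can be applied to it.
  module Play (s : S) (next : List S → (t : S) → Move t) where
    history : ℕ → List S × S
    history zero    = [] , s
    history (suc i) = let (h , t) = history i in h ∷ʳ t , δ t (next h t)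

    run : ℕ → S
    run i = proj₂ (history i)

    history-prefix : ∀ i → proj₁ (history i) ≡ prefix run i
    history-prefix zero    = refl
    history-prefix (suc i) = begin
      proj₁ (history i) ∷ʳ run i      ≡⟨ cong (_∷ʳ run i) (history-prefix i) ⟩
      map run (upTo i) ∷ʳ run i       ≡⟨ sym (map-++ run (upTo i) (i ∷ [])) ⟩
      map run (upTo i ∷ʳ i)           ≡⟨ cong (map run) (upTo-∷ʳ i) ⟩
      prefix run (suc i)              ∎
      where open ≡-Reasoning

    run-suc : ∀ i → run (suc i) ≡ δ (run i) (next (prefix run i) (run i))
    run-suc i = cong (λ h → δ (run i) (next h (run i))) (history-prefix i)

  open Play public using (run; run-suc)

  jointMove : {A : Subset n} → Strategy A → CoStrategy A → List S → (t : S) → Move t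
  jointMove G G′ h t = proj₁ (G′ h t) (G h t)

  module _ {A : Subset n} (s : S) (G : Strategy A) (G′ : CoStrategy A) where
    private r = run s (jointMove G G′)

    joint-∈-out : InOutS A s G r
    joint-∈-out = refl , λ i →
      jointMove G G′ (prefix r i) (r i) , proj₂ (G′ _ _) (G _ _) , sym (run-suc s _ i)

    joint-∈-coOut : InOutCoS A s G′ r
    joint-∈-coOut = refl , λ i → G (prefix r i) (r i) , sym (run-suc s _ i)

  invariant-along-outcome : {A : Subset n} {G : Strategy A} (P : S → Set) →
    (∀ h t → P t → ∀ t′ → InOut A t (G h t) t′ → P t′) →
    ∀ {s r} → P s → InOutS A s G r → ∀ i → P (r i)
  invariant-along-outcome P step Ps (refl , out) zero    = Ps
  invariant-along-outcome P step Ps (refl , out) (suc i) =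
    step _ _ (invariant-along-outcome P step Ps (refl , out) i) _ (out i)

module Truth {n : ℕ} {AP : Set} (𝓗 : CGHS n AP) where
  open CGHS 𝓗
  open Semantics frame label
  open Outcomes frame

  ∧-elim : ∀ {t φ ψ} → t ∋ (φ ∧ ψ) → (t ∋ φ) × (t ∋ ψ)
  ∧-elim {t} {φ} {ψ} m = let (mφ , m~~ψ) = H2-¬⇒ t φ (~ ψ) m in mφ , H2-¬¬ t ψ m~~ψ

  ~𝒰⇒~ψ : ∀ {t A φ ψ} → t ∋ (~ (⟪ A ⟫ φ 𝒰 ψ)) → t ∋ (~ ψ)
  ~𝒰⇒~ψ {t} {A} {φ} {ψ} m =
    [ (λ c → proj₁ (∧-elim c)) , (λ c → proj₁ (∧-elim c)) ]′ (H3-¬𝒰 t A φ ψ m)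

  -- Wherever ⟪A⟫□φ is in the label, play the A-move that (H4) provides for
  -- ⟪A⟫○⟪A⟫□φ; elsewhere the choice is irrelevant.
  boxStrategy : (A : Subset n) (φ : Formula n AP) → Strategy A
  boxStrategy A φ _ t =
    choose (H t (⟪ A ⟫□ φ)) (λ m → proj₁ (H4 t A _ (proj₂ (H2-□ t A φ m)))) (defaultAMove A t)

  boxStrategy-preserves : ∀ A φ h t → t ∋ (⟪ A ⟫□ φ) →
    ∀ t′ → InOut A t (boxStrategy A φ h t) t′ → t′ ∋ (⟪ A ⟫□ φ)
  boxStrategy-preserves A φ h t =
    choose-true (λ σA → ∀ t′ → InOut A t σA t′ → t′ ∋ (⟪ A ⟫□ φ)) (H t (⟪ A ⟫□ φ)) _ _
      (λ m → proj₂ (H4 t A _ (proj₂ (H2-□ t A φ m))))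

  -- Dually, wherever ¬⟪A⟫○⟪A⟫φ𝒰ψ is in the label, play the co-A-move of (H5).
  untilCoStrategy : (A : Subset n) (φ ψ : Formula n AP) → CoStrategy A
  untilCoStrategy A φ ψ _ t =
    choose (H t (~ (⟪ A ⟫○ (⟪ A ⟫ φ 𝒰 ψ)))) (λ m → proj₁ (H5 t A _ m)) (defaultCoAMove A t)

  untilCoStrategy-preserves : ∀ A φ ψ h t → t ∋ (~ (⟪ A ⟫○ (⟪ A ⟫ φ 𝒰 ψ))) →
    ∀ σA → δ t (proj₁ (untilCoStrategy A φ ψ h t) σA) ∋ (~ (⟪ A ⟫ φ 𝒰 ψ))
  untilCoStrategy-preserves A φ ψ h t =
    choose-true (λ c → ∀ σA → δ t (proj₁ c σA) ∋ (~ (⟪ A ⟫ φ 𝒰 ψ)))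
      (H t (~ (⟪ A ⟫○ (⟪ A ⟫ φ 𝒰 ψ)))) (λ m → proj₁ (H5 t A _ m)) (defaultCoAMove A t)
      (λ m σA → proj₂ (H5 t A _ m) _ (σA , refl))

  module _ {A : Subset n} {φ : Formula n AP} where
    sound-□ : (∀ t → t ∋ φ → Sat t φ) → ∀ {s} → s ∋ (⟪ A ⟫□ φ) → Sat s (⟪ A ⟫□ φ)
    sound-□ sound-φ m = boxStrategy A φ , λ r out i →
      sound-φ (r i) (proj₁ (H2-□ (r i) A φ
        (invariant-along-outcome _ (boxStrategy-preserves A φ) m out i)))

    sound-~□ : (∀ t → t ∋ (~ φ) → ¬ Sat t φ) → ∀ {s} → s ∋ (~ (⟪ A ⟫□ φ)) → ¬ Sat s (⟪ A ⟫□ φ)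
    sound-~□ sound-~φ {s} m (G , always) =
      let (G′ , eventually) = H7 s A φ m
          (i , m~φ) = eventually _ (joint-∈-coOut s G G′)
      in sound-~φ _ m~φ (always _ (joint-∈-out s G G′) i)

  module _ {A : Subset n} {φ ψ : Formula n AP} (sound-~φ : ∀ t → t ∋ (~ φ) → ¬ Sat t φ) where
    private
      U = ⟪ A ⟫ φ 𝒰 ψ

      jointRun : S → Strategy A → ℕ → S
      jointRun s G = run s (jointMove G (untilCoStrategy A φ ψ))

    -- While φ keeps holding, the β-rule for ¬U can only take its second
    -- branch, so untilCoStrategy carries ¬U along the joint run.
    ~𝒰-until-released : ∀ {s} (G : Strategy A) → s ∋ (~ U) →
      ∀ i → (∀ j → j < i → Sat (jointRun s G j) φ) → jointRun s G i ∋ (~ U)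
    ~𝒰-until-released G m zero    _     = m
    ~𝒰-until-released {s} G m (suc i) φ-before
      with H3-¬𝒰 (jointRun s G i) A φ ψ
             (~𝒰-until-released G m i (λ j j<i → φ-before j (m<n⇒m<1+n j<i)))
    ... | inj₁ c = ⊥-elim (sound-~φ _ (proj₂ (∧-elim c)) (φ-before i ≤-refl))
    ... | inj₂ c = subst (_∋ (~ U)) (sym (run-suc s (jointMove G (untilCoStrategy A φ ψ)) i))
          (untilCoStrategy-preserves A φ ψ (prefix (jointRun s G) i) _ (proj₂ (∧-elim c)) _)

    sound-~𝒰 : (∀ t → t ∋ (~ ψ) → ¬ Sat t ψ) → ∀ {s} → s ∋ (~ U) → ¬ Sat s U
    sound-~𝒰 sound-~ψ {s} m (G , eventually)
      with eventually (jointRun s G) (joint-∈-out s G (untilCoStrategy A φ ψ))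
    ... | i , ψ-at-i , φ-before =
      sound-~ψ _ (~𝒰⇒~ψ (~𝒰-until-released G m i φ-before)) ψ-at-i

  sound-𝒰 : ∀ {A φ ψ} → (∀ t → t ∋ φ → Sat t φ) → (∀ t → t ∋ ψ → Sat t ψ) →
    ∀ {s} → s ∋ (⟪ A ⟫ φ 𝒰 ψ) → Sat s (⟪ A ⟫ φ 𝒰 ψ)
  sound-𝒰 {A} {φ} {ψ} sound-φ sound-ψ {s} m =
    let (G , reaches) = H6 s A φ ψ m in
    G , λ r out → let (i , ψ-at-i , φ-before) = reaches r out in
      i , sound-ψ (r i) ψ-at-i , λ j j<i → sound-φ (r j) (φ-before j j<i)

  ∋⇒Sat  : ∀ φ s → s ∋ φ → Sat s φ
  ∋~⇒¬Sat : ∀ φ s → s ∋ (~ φ) → ¬ Sat s φ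

  ∋⇒Sat (atom p)        s m = m
  ∋⇒Sat (~ φ)           s m = ∋~⇒¬Sat φ s m
  ∋⇒Sat (φ ⇒ ψ)         s m Sφ =
    [ (λ m~φ → ⊥-elim (∋~⇒¬Sat φ s m~φ Sφ)) , ∋⇒Sat ψ s ]′ (H3-⇒ s φ ψ m)
  ∋⇒Sat (⟪ A ⟫○ φ)      s m =
    let (σA , next) = H4 s A φ m in σA , λ t out → ∋⇒Sat φ t (next t out)
  ∋⇒Sat (⟪ A ⟫□ φ)      s m = sound-□ (∋⇒Sat φ) m
  ∋⇒Sat (⟪ A ⟫ φ 𝒰 ψ)   s m = sound-𝒰 (∋⇒Sat φ) (∋⇒Sat ψ) m

  ∋~⇒¬Sat (atom p)      s m = H1 s (atom p) m
  ∋~⇒¬Sat (~ φ)         s m ¬Sφ = ¬Sφ (∋⇒Sat φ s (H2-¬¬ s φ m))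
  ∋~⇒¬Sat (φ ⇒ ψ)       s m Sφ⇒ψ =
    let (mφ , m~ψ) = H2-¬⇒ s φ ψ m in ∋~⇒¬Sat ψ s m~ψ (Sφ⇒ψ (∋⇒Sat φ s mφ))
  ∋~⇒¬Sat (⟪ A ⟫○ φ)    s m (σA , next) =
    let (c , next~) = H5 s A φ m
        t = δ s (proj₁ c σA)
    in ∋~⇒¬Sat φ t (next~ t (σA , refl)) (next t (proj₁ c σA , proj₂ c σA , refl))
  ∋~⇒¬Sat (⟪ A ⟫□ φ)    s m = sound-~□ (∋~⇒¬Sat φ) m
  ∋~⇒¬Sat (⟪ A ⟫ φ 𝒰 ψ) s m = sound-~𝒰 (∋~⇒¬Sat φ) (∋~⇒¬Sat ψ) m

mainTheorem5 : (n : ℕ) → 1 ≤ n → (AP : Set) (θ : Formula n AP) (𝓗 : CGHS n AP) →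
    IsFor 𝓗 θ → SatisfiedInExpansion 𝓗 θ
mainTheorem5 n _ AP θ 𝓗 (s , θ∈Hs) = s , Truth.∋⇒Sat 𝓗 θ s θ∈Hs
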